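{- Let $\ell\ge4$. Then $\mu(\ell,n)\le\dfrac{(n-2)(n-3)}{2(\ell-3)}$.
   Context: An $\ell$-cycle system of order $n$ is a set of $\ell$-cycles whose edge sets partition the edge set of $K_n$. Two such systems $\mathcal F,\mathcal F'$ are orthogonal if every $C\in\mathcal F$ and $C'\in\mathcal F'$ share at most one edge; mutually orthogonal means pairwise orthogonal. $\mu(\ell,n)$ is the maximum size of a set of mutually orthogonal $\ell$-cycle systems of order $n$. -}

module Defs where

open import Data.Nat using (ℕ; suc; zero)
open import Data.Fin using (Fin; toℕ)
open import Data.Product using (Σ; ∃; _×_; _,_)
open import Data.Sum using (_⊎_)
open import Relation.Binary.PropositionalEquality using (_≡_; _≢_)
open import Function.Definitions using (Injective)

-- An ℓ-cycle in K_n: an injective cyclic sequence of ℓ vertices of Fin n.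
-- (Different rotations/reflections represent the same cycle; all notions
-- below depend only on the edge set, so this is harmless.)
record Cycle (ℓ n : ℕ) : Set where
  constructor mkCycle
  field
    vtx : Fin ℓ → Fin n
    inj : Injective _≡_ _≡_ vtx
open Cycle public

Consec : {ℓ : ℕ} → Fin ℓ → Fin ℓ → Set
Consec {ℓ} i j = (suc (toℕ i) ≡ toℕ j) ⊎ (suc (toℕ i) ≡ ℓ × toℕ j ≡ 0)

HasEdge : {ℓ n : ℕ} → Cycle ℓ n → Fin n → Fin n → Set
HasEdge {ℓ} C u v =
  ∃ λ (i : Fin ℓ) → ∃ λ (j : Fin ℓ) → Consec i j ×
    ((vtx C i ≡ u × vtx C j ≡ v) ⊎ (vtx C i ≡ v × vtx C j ≡ u))

SameEdge : {n : ℕ} → Fin n → Fin n → Fin n → Fin n → Set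
SameEdge u v x y = (u ≡ x × v ≡ y) ⊎ (u ≡ y × v ≡ x)

record CycleSystem (ℓ n : ℕ) : Set where
  field
    size   : ℕ
    cycle  : Fin size → Cycle ℓ n
    cover  : (u v : Fin n) → u ≢ v →
             Σ (Fin size) λ p → HasEdge (cycle p) u v ×
               ((q : Fin size) → HasEdge (cycle q) u v → q ≡ p)
open CycleSystem public

AtMostOneCommonEdge : {ℓ n : ℕ} → Cycle ℓ n → Cycle ℓ n → Set
AtMostOneCommonEdge C D = ∀ u v x y →
  HasEdge C u v → HasEdge D u v → HasEdge C x y → HasEdge D x y →
  SameEdge u v x y

Orthogonal : {ℓ n : ℕ} → CycleSystem ℓ n → CycleSystem ℓ n → Set
Orthogonal F G = (p : Fin (size F)) (q : Fin (size G)) →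
  AtMostOneCommonEdge (cycle F p) (cycle G q)

MutuallyOrthogonal : {ℓ n k : ℕ} → (Fin k → CycleSystem ℓ n) → Set
MutuallyOrthogonal {k = k} 𝓕 = (i j : Fin k) → i ≢ j → Orthogonal (𝓕 i) (𝓕 j)

-- Fix the edge {0,1} of K_n. In each system it lies in a unique ℓ-cycle, and walking
-- around that cycle starting with {0,1}, its other ℓ − 3 edges avoid both 0 and 1.
-- Orthogonality forbids two of these cycles (from different systems) to share an edge
-- other than {0,1}, so the 2(ℓ − 3)k orientations of these edges are distinct ordered
-- pairs of distinct vertices among the n − 2 vertices other than 0 and 1.
module Submission where

open import Defs
open import Data.Nat using (ℕ; zero; suc; _+_; _*_; _∸_; _≤_; _<_; _<?_; s≤s)
open import Data.Nat.Properties
  using (≤-reflexive; ≤-trans; ≤-antisym; ≤-<-trans; <-trans; <⇒≤; <⇒≢; <⇒≱; ≮⇒≥; n<1+n; module ≤-Reasoning;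
         +-identityʳ; +-suc; +-cancelˡ-≡; +-cancelˡ-≤; +-monoˡ-≤; +-monoʳ-<; m≤m+n;
         n∸n≡0; m+n∸n≡m; m∸n+n≡m; +-∸-assoc; ∸-monoʳ-≤; m≢1+n+m)
open import Data.Fin using (Fin; zero; suc; toℕ; fromℕ<; inject₁; combine; remQuot; punchOut)
open import Data.Fin.Properties
  using (toℕ<n; toℕ-fromℕ<; toℕ-injective; toℕ-inject₁; inject₁-injective; suc-injective; 0≢1+n;
         combine-injective; combine-remQuot; punchOut-injective; injective⇒≤; _≟_)
open import Data.Product using (_×_; _,_; proj₁; proj₂; map; map₁; swap; uncurry)
open import Data.Sum using (_⊎_; inj₁; inj₂)
open import Function using (id; _∘_)
open import Function.Definitions using (Injective)
open import Relation.Nullary using (¬_; yes; no; contradiction)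
open import Relation.Binary.PropositionalEquality

shift : ℕ → ℕ → ℕ → ℕ
shift ℓ t m with t + m <? ℓ
... | yes _ = t + m
... | no  _ = t + m ∸ ℓ

shift-< : ∀ {ℓ t m} → t < ℓ → m < ℓ → shift ℓ t m < ℓ
shift-< {ℓ} {t} {m} t<ℓ m<ℓ with t + m <? ℓ
... | yes t+m<ℓ = t+m<ℓ
... | no  _     = ≤-<-trans (≤-trans (∸-monoʳ-≤ (t + m) (<⇒≤ m<ℓ)) (≤-reflexive (m+n∸n≡m t m))) t<ℓ

wrapped-collision : ∀ {ℓ} t m m' → ℓ ≤ t + m' → t + m ≡ t + m' ∸ ℓ → ℓ ≤ m'
wrapped-collision {ℓ} t m m' ℓ≤t+m' eq = +-cancelˡ-≤ t ℓ m' (begin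
  t + ℓ          ≤⟨ +-monoˡ-≤ ℓ (m≤m+n t m) ⟩
  t + m + ℓ      ≡⟨ cong (_+ ℓ) eq ⟩
  t + m' ∸ ℓ + ℓ ≡⟨ m∸n+n≡m ℓ≤t+m' ⟩
  t + m'         ∎)
  where open ≤-Reasoning

shift-injective : ∀ {ℓ t m m'} → m < ℓ → m' < ℓ → shift ℓ t m ≡ shift ℓ t m' → m ≡ m'
shift-injective {ℓ} {t} {m} {m'} m<ℓ m'<ℓ eq with t + m <? ℓ | t + m' <? ℓ
... | yes _ | yes _ = +-cancelˡ-≡ t m m' eq
... | no  a | no  b = +-cancelˡ-≡ t m m'
  (trans (sym (m∸n+n≡m (≮⇒≥ a))) (trans (cong (_+ ℓ) eq) (m∸n+n≡m (≮⇒≥ b))))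
... | yes _ | no  b = contradiction (wrapped-collision t m m' (≮⇒≥ b) eq) (<⇒≱ m'<ℓ)
... | no  a | yes _ = contradiction (wrapped-collision t m' m (≮⇒≥ a) (sym eq)) (<⇒≱ m<ℓ)

shift-zero : ∀ {ℓ t} → t < ℓ → shift ℓ t 0 ≡ t
shift-zero {ℓ} {t} t<ℓ with t + 0 <? ℓ
... | yes _   = +-identityʳ t
... | no  t≮ℓ = contradiction (subst (_< ℓ) (sym (+-identityʳ t)) t<ℓ) t≮ℓ

shift-suc : ∀ ℓ t m → (suc (shift ℓ t m) ≡ shift ℓ t (suc m))
                    ⊎ (suc (shift ℓ t m) ≡ ℓ × shift ℓ t (suc m) ≡ 0)
shift-suc ℓ t m with t + m <? ℓ | t + suc m <? ℓ
... | yes _ | yes _ = inj₁ (sym (+-suc t m))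
... | yes a | no  b = inj₂ (wraps , trans (cong (_∸ ℓ) (trans (+-suc t m) wraps)) (n∸n≡0 ℓ))
  where
  wraps : suc (t + m) ≡ ℓ
  wraps = ≤-antisym a (subst (ℓ ≤_) (+-suc t m) (≮⇒≥ b))
... | no  a | yes b = contradiction (<-trans (+-monoʳ-< t (n<1+n m)) b) a
... | no  a | no  _ = inj₁ (begin
  suc (t + m ∸ ℓ) ≡⟨ sym (+-∸-assoc 1 (≮⇒≥ a)) ⟩
  suc (t + m) ∸ ℓ ≡⟨ cong (_∸ ℓ) (sym (+-suc t m)) ⟩
  t + suc m ∸ ℓ   ∎)
  where open ≡-Reasoning

rotate : ∀ {ℓ} → Fin ℓ → Fin ℓ → Fin ℓ
rotate t m = fromℕ< (shift-< (toℕ<n t) (toℕ<n m))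

toℕ-rotate : ∀ {ℓ} (t m : Fin ℓ) → toℕ (rotate t m) ≡ shift ℓ (toℕ t) (toℕ m)
toℕ-rotate t m = toℕ-fromℕ< _

rotate-injective : ∀ {ℓ} (t : Fin ℓ) → Injective _≡_ _≡_ (rotate t)
rotate-injective t {m} {m'} eq = toℕ-injective (shift-injective (toℕ<n m) (toℕ<n m')
  (trans (sym (toℕ-rotate t m)) (trans (cong toℕ eq) (toℕ-rotate t m'))))

rotate-zero : ∀ {ℓ} (t : Fin (suc ℓ)) → rotate t zero ≡ t
rotate-zero t = toℕ-injective (trans (toℕ-rotate t zero) (shift-zero (toℕ<n t)))

rotate-consec : ∀ {ℓ} (t : Fin (suc ℓ)) (m : Fin ℓ) → Consec (rotate t (inject₁ m)) (rotate t (suc m))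
rotate-consec {ℓ} t m = subst₂ (λ a b → (suc a ≡ b) ⊎ (suc a ≡ suc ℓ × b ≡ 0))
  (sym (trans (toℕ-rotate t (inject₁ m)) (cong (shift (suc ℓ) (toℕ t)) (toℕ-inject₁ m))))
  (sym (toℕ-rotate t (suc m)))
  (shift-suc (suc ℓ) (toℕ t) (toℕ m))

Consec-unique : ∀ {ℓ} {i j j' : Fin ℓ} → Consec i j → Consec i j' → j ≡ j'
Consec-unique (inj₁ a)       (inj₁ b)       = toℕ-injective (trans (sym a) b)
Consec-unique (inj₂ (_ , a)) (inj₂ (_ , b)) = toℕ-injective (trans a (sym b))
Consec-unique {j = j}  (inj₁ a) (inj₂ (b , _)) = contradiction (trans (sym a) b) (<⇒≢ (toℕ<n j))
Consec-unique {j' = j'} (inj₂ (a , _)) (inj₁ b) = contradiction (trans (sym b) a) (<⇒≢ (toℕ<n j'))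

rotate-one : ∀ {ℓ} {t j : Fin (suc (suc ℓ))} → Consec t j → rotate t (suc zero) ≡ j
rotate-one {t = t} t~j =
  Consec-unique (subst (λ i → Consec i (rotate t (suc zero))) (rotate-zero t) (rotate-consec t zero)) t~j

walk : ∀ {ℓ n} → Cycle ℓ n → Fin ℓ → Fin ℓ → Fin n
walk C t = vtx C ∘ rotate t

walk-injective : ∀ {ℓ n} (C : Cycle ℓ n) (t : Fin ℓ) → Injective _≡_ _≡_ (walk C t)
walk-injective C t = rotate-injective t ∘ inj C

walk-edge : ∀ {ℓ n} (C : Cycle (suc ℓ) n) (t : Fin (suc ℓ)) (m : Fin ℓ) →
            HasEdge C (walk C t (inject₁ m)) (walk C t (suc m))
walk-edge C t m = rotate t (inject₁ m) , rotate t (suc m) , rotate-consec t m , inj₁ (refl , refl)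

HasEdge-sym : ∀ {ℓ n} {C : Cycle ℓ n} {u v : Fin n} → HasEdge C u v → HasEdge C v u
HasEdge-sym (i , j , i~j , inj₁ (p , q)) = i , j , i~j , inj₂ (p , q)
HasEdge-sym (i , j , i~j , inj₂ (p , q)) = i , j , i~j , inj₁ (p , q)

walk-≢-start : ∀ {ℓ n} (C : Cycle (suc ℓ) n) (t : Fin (suc ℓ)) (r : Fin ℓ) →
               walk C t (suc r) ≢ vtx C t
walk-≢-start C t r eq = 0≢1+n (sym (walk-injective C t (trans eq (sym (cong (vtx C) (rotate-zero t))))))

walk-≢-next : ∀ {ℓ n} (C : Cycle (suc (suc ℓ)) n) {t j : Fin (suc (suc ℓ))} → Consec t j →
              (r : Fin ℓ) → walk C t (suc (suc r)) ≢ vtx C j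
walk-≢-next C {t} t~j r eq =
  0≢1+n (sym (suc-injective (walk-injective C t (trans eq (sym (cong (vtx C) (rotate-one t~j)))))))

walk-avoids : ∀ {ℓ n} (C : Cycle (suc (suc ℓ)) n) {u v : Fin n} (e : HasEdge C u v) (r : Fin ℓ) →
              walk C (proj₁ e) (suc (suc r)) ≢ u × walk C (proj₁ e) (suc (suc r)) ≢ v
walk-avoids C (t , j , t~j , inj₁ (refl , refl)) r = walk-≢-start C t (suc r) , walk-≢-next C t~j r
walk-avoids C (t , j , t~j , inj₂ (refl , refl)) r = walk-≢-next C t~j r , walk-≢-start C t (suc r)

dropTwo : ∀ {m} (x : Fin (suc (suc m))) → x ≢ zero → x ≢ suc zero → Fin m
dropTwo zero          x≢0 _   = contradiction refl x≢0
dropTwo (suc zero)    _   x≢1 = contradiction refl x≢1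
dropTwo (suc (suc x)) _   _   = x

dropTwo-injective : ∀ {m} (x y : Fin (suc (suc m))) x≢0 x≢1 y≢0 y≢1 →
                    dropTwo x x≢0 x≢1 ≡ dropTwo y y≢0 y≢1 → x ≡ y
dropTwo-injective zero          _             x≢0 _   _   _   _  = contradiction refl x≢0
dropTwo-injective (suc zero)    _             _   x≢1 _   _   _  = contradiction refl x≢1
dropTwo-injective (suc (suc _)) zero          _   _   y≢0 _   _  = contradiction refl y≢0
dropTwo-injective (suc (suc _)) (suc zero)    _   _   _   y≢1 _  = contradiction refl y≢1
dropTwo-injective (suc (suc _)) (suc (suc _)) _   _   _   _   eq = cong (λ z → suc (suc z)) eq

offDiagonalCode : ∀ {m} (a b : Fin m) → a ≢ b → Fin (m * (m ∸ 1))
offDiagonalCode {suc _} a b a≢b = combine a (punchOut a≢b)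

offDiagonalCode-injective : ∀ {m} {a b c d : Fin m} (a≢b : a ≢ b) (c≢d : c ≢ d) →
                            offDiagonalCode a b a≢b ≡ offDiagonalCode c d c≢d → (a , b) ≡ (c , d)
offDiagonalCode-injective {suc _} {a} {b} {c} {d} a≢b c≢d eq
  with combine-injective a (punchOut a≢b) c (punchOut c≢d) eq
... | refl , eq′ = cong (a ,_) (punchOut-injective a≢b c≢d eq′)

offDiagonal-injection⇒≤ : ∀ {N m} (f : Fin N → Fin m × Fin m) → Injective _≡_ _≡_ f →
                          (∀ x → proj₁ (f x) ≢ proj₂ (f x)) → N ≤ m * (m ∸ 1)
offDiagonal-injection⇒≤ {N} {m} f f-injective f-offDiagonal =
  injective⇒≤ {f = code} (f-injective ∘ offDiagonalCode-injective (f-offDiagonal _) (f-offDiagonal _))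
  where
  code : Fin N → Fin (m * (m ∸ 1))
  code x = offDiagonalCode (proj₁ (f x)) (proj₂ (f x)) (f-offDiagonal x)

remQuot-injective : ∀ {n} k → Injective _≡_ _≡_ (remQuot {n} k)
remQuot-injective {n} k {i} {j} eq =
  trans (sym (combine-remQuot {n} k i)) (trans (cong (uncurry combine) eq) (combine-remQuot {n} k j))

splitIndex : ∀ a b k → Fin (a * b * k) → (Fin a × Fin b) × Fin k
splitIndex a b k = map₁ (remQuot b) ∘ remQuot k

splitIndex-injective : ∀ a b k → Injective _≡_ _≡_ (splitIndex a b k)
splitIndex-injective a b k eq = remQuot-injective k
  (cong₂ _,_ (remQuot-injective {a} b (cong proj₁ eq)) (cong proj₂ eq))

SameEdge-avoid : ∀ {n} {u v x y : Fin n} → x ≢ u → x ≢ v → ¬ SameEdge u v x y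
SameEdge-avoid x≢u _   (inj₁ (u≡x , _)) = x≢u (sym u≡x)
SameEdge-avoid _   x≢v (inj₂ (_ , v≡x)) = x≢v (sym v≡x)

orient : ∀ {A : Set} → Fin 2 → A × A → A × A
orient zero       = id
orient (suc zero) = swap

directedStep : ∀ {ℓ} → Fin 2 → Fin ℓ → Fin (suc ℓ) × Fin (suc ℓ)
directedStep b q = orient b (inject₁ q , suc q)

inject₁≢suc : ∀ {ℓ} (q : Fin ℓ) → inject₁ q ≢ suc q
inject₁≢suc zero    = 0≢1+n
inject₁≢suc (suc q) = inject₁≢suc q ∘ suc-injective

directedStep-offDiagonal : ∀ {ℓ} b (q : Fin ℓ) → proj₁ (directedStep b q) ≢ proj₂ (directedStep b q)
directedStep-offDiagonal zero       q = inject₁≢suc q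
directedStep-offDiagonal (suc zero) q = inject₁≢suc q ∘ sym

inject₁≡suc⇒suc≢inject₁ : ∀ {ℓ} {q q' : Fin ℓ} → inject₁ q ≡ suc q' → suc q ≢ inject₁ q'
inject₁≡suc⇒suc≢inject₁ {q = q} {q'} p r = m≢1+n+m (toℕ q') (begin
  toℕ q'             ≡⟨ sym (trans (cong toℕ r) (toℕ-inject₁ q')) ⟩
  suc (toℕ q)        ≡⟨ cong suc (trans (sym (toℕ-inject₁ q)) (cong toℕ p)) ⟩
  suc (suc (toℕ q')) ∎)
  where open ≡-Reasoning

directedStep-injective : ∀ {ℓ} {b b' : Fin 2} {q q' : Fin ℓ} →
                         directedStep b q ≡ directedStep b' q' → (b , q) ≡ (b' , q')
directedStep-injective {b = zero}     {zero}     eq = cong (zero ,_) (inject₁-injective (cong proj₁ eq))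
directedStep-injective {b = suc zero} {suc zero} eq = cong (suc zero ,_) (suc-injective (cong proj₁ eq))
directedStep-injective {b = zero}     {suc zero} eq =
  contradiction (cong proj₂ eq) (inject₁≡suc⇒suc≢inject₁ (cong proj₁ eq))
directedStep-injective {b = suc zero} {zero}     eq =
  contradiction (cong proj₁ eq) (inject₁≡suc⇒suc≢inject₁ (cong proj₂ eq))

module InnerArcs {c m k : ℕ} (𝓕 : Fin k → CycleSystem (3 + c) (2 + m))
                 (orthogonal : MutuallyOrthogonal 𝓕) where

  index01 : (i : Fin k) → Fin (size (𝓕 i))
  index01 i = proj₁ (cover (𝓕 i) zero (suc zero) 0≢1+n)

  C : Fin k → Cycle (3 + c) (2 + m)
  C i = cycle (𝓕 i) (index01 i)

  C-has01 : (i : Fin k) → HasEdge (C i) zero (suc zero)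
  C-has01 i = proj₁ (proj₂ (cover (𝓕 i) zero (suc zero) 0≢1+n))

  C-shareOnly01 : ∀ {i i' x y} → i ≢ i' → HasEdge (C i) x y → HasEdge (C i') x y →
                  SameEdge zero (suc zero) x y
  C-shareOnly01 {i} {i'} i≢i' =
    orthogonal i i' i≢i' (index01 i) (index01 i') zero (suc zero) _ _ (C-has01 i) (C-has01 i')

  start : Fin k → Fin (3 + c)
  start i = proj₁ (C-has01 i)

  inner : Fin k → Fin (suc c) → Fin (2 + m)
  inner i q = walk (C i) (start i) (suc (suc q))

  inner-avoids01 : ∀ i q → inner i q ≢ zero × inner i q ≢ suc zero
  inner-avoids01 i = walk-avoids (C i) (C-has01 i)

  inner-injective : ∀ i → Injective _≡_ _≡_ (inner i)
  inner-injective i = suc-injective ∘ suc-injective ∘ walk-injective (C i) (start i)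

  innerEdge : ∀ i b q → HasEdge (C i) (inner i (proj₁ (directedStep b q))) (inner i (proj₂ (directedStep b q)))
  innerEdge i zero       q = walk-edge (C i) (start i) (suc (suc q))
  innerEdge i (suc zero) q = HasEdge-sym {C = C i} (walk-edge (C i) (start i) (suc (suc q)))

  label : Fin k → Fin (suc c) → Fin m
  label i q = dropTwo (inner i q) (proj₁ (inner-avoids01 i q)) (proj₂ (inner-avoids01 i q))

  label-inner : ∀ {i i' q q'} → label i q ≡ label i' q' → inner i q ≡ inner i' q'
  label-inner = dropTwo-injective _ _ _ _ _ _

  arc : (Fin 2 × Fin c) × Fin k → Fin m × Fin m
  arc ((b , q) , i) = map (label i) (label i) (directedStep b q)

  arc-offDiagonal : ∀ x → proj₁ (arc x) ≢ proj₂ (arc x)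
  arc-offDiagonal ((b , q) , i) = directedStep-offDiagonal b q ∘ inner-injective i ∘ label-inner

  arc-injective : Injective _≡_ _≡_ arc
  arc-injective {(b , q) , i} {(b' , q') , i'} eq with i ≟ i'
  ... | yes refl = cong (_, i) (directedStep-injective (cong₂ _,_
        (inner-injective i (label-inner (cong proj₁ eq)))
        (inner-injective i (label-inner (cong proj₂ eq)))))
  ... | no i≢i' = contradiction
        (C-shareOnly01 i≢i' (innerEdge i b q)
          (subst₂ (HasEdge (C i')) (sym (label-inner (cong proj₁ eq))) (sym (label-inner (cong proj₂ eq)))
                  (innerEdge i' b' q')))
        (SameEdge-avoid (proj₁ (inner-avoids01 i _)) (proj₂ (inner-avoids01 i _)))

lemma20 : (ℓ n k : ℕ) → 4 ≤ ℓ → 2 ≤ n →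
          (𝓕 : Fin k → CycleSystem ℓ n) → MutuallyOrthogonal 𝓕 →
          2 * (ℓ ∸ 3) * k ≤ (n ∸ 2) * (n ∸ 3)
lemma20 (suc (suc (suc c))) (suc (suc m)) k _ _ 𝓕 orthogonal =
  offDiagonal-injection⇒≤ (arc ∘ splitIndex 2 c k)
    (splitIndex-injective 2 c k ∘ arc-injective) (arc-offDiagonal ∘ splitIndex 2 c k)
  where open InnerArcs 𝓕 orthogonal
lemma20 _                   zero          _ _ ()        _ _
lemma20 _                   (suc zero)    _ _ (s≤s ())  _ _
lemma20 zero                _             _ ()                  _ _ _
lemma20 (suc zero)          _             _ (s≤s ())            _ _ _
lemma20 (suc (suc zero))    _             _ (s≤s (s≤s ()))      _ _ _
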